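{- Let $S[1:n]$ be a sequence of distinct real numbers, $k\ge3$, and let $1\le i<m\le j\le n$. Let $A_{\mathsf{inc}}$ be the $(m-i)\times(j+1-m)$ matrix with rows indexed $i,\dots,m-1$ and columns indexed $m,\dots,j$, defined by $A_{\mathsf{inc}}[x,y]=\mathsf{dec}[x]+M'[x-1,y]-1$ if $M'[x-1,y]\neq-\infty$, and $A_{\mathsf{inc}}[x,y]$ blank otherwise. Then $A_{\mathsf{inc}}$ is a falling staircase anti-Monge matrix.
   Context: $S[a:b]$ denotes the contiguous subsequence $(S[a],\dots,S[b])$; subsequences need not be contiguous. A run is a maximal contiguous subsequence that is increasing or decreasing; a $k$-rollercoaster is a sequence every run of which has length at least $k$. $\mathsf{dec}[x]$ is the length of a longest subsequence of $S[1:x]$ that is a $k$-rollercoaster with last run decreasing ($0$ if none). $M$ is the $(n+1)\times(n+1)$ matrix indexed from $0$ with $M[a,b]$ the length of a longest increasing subsequence of $S[a+1:b]$ if $a<b$ and $M[a,b]=b-a$ otherwise; $M'$ is $M$ with every entry less than $k$ replaced by $-\infty$. A matrix with blanks is a falling staircase anti-Monge matrix if for every blank entry all entries below it and to its left are blanks, and for all rows $r_1<r_2$ and columns $c_1<c_2$ such that the four entries are non-blank, $A[r_1,c_1]+A[r_2,c_2]\ge A[r_1,c_2]+A[r_2,c_1]$. -}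

module Defs where

open import Level using (Level)
open import Data.Bool using (Bool; true; false; _∧_; if_then_else_)
open import Data.Nat as ℕ using (ℕ; zero; suc; _⊔_; _∸_; _<ᵇ_)
open import Data.Integer as ℤ using (ℤ; +_)
open import Data.List using (List; []; _∷_; _++_; map; length; foldr; upTo; last)
open import Data.Maybe using (Maybe; just; nothing)
open import Relation.Nullary.Decidable using (⌊_⌋)
open import Relation.Binary.Bundles using (StrictTotalOrder)
open import Relation.Binary.PropositionalEquality using (_≡_)

-- All notions are relative to a strict total order (e.g. the reals);
-- the sequence S is a function ℕ → Carrier of which only S 1 … S n matter.
module Rollercoaster {a ℓ₁ ℓ₂ : Level} (O : StrictTotalOrder a ℓ₁ ℓ₂) where
  open StrictTotalOrder O renaming (Carrier to C)

  subseqs : List C → List (List C)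
  subseqs [] = [] ∷ []
  subseqs (x ∷ xs) = map (x ∷_) (subseqs xs) ++ subseqs xs

  increasing : List C → Bool
  increasing [] = true
  increasing (x ∷ []) = true
  increasing (x ∷ y ∷ r) = ⌊ x <? y ⌋ ∧ increasing (y ∷ r)

  decreasing : List C → Bool
  decreasing [] = true
  decreasing (x ∷ []) = true
  decreasing (x ∷ y ∷ r) = ⌊ y <? x ⌋ ∧ decreasing (y ∷ r)

  data Dir : Set where
    up down : Dir

  dir : C → C → Dir
  dir x y = if ⌊ x <? y ⌋ then up else down

  sameDir : Dir → Dir → Bool
  sameDir up up = true
  sameDir down down = true
  sameDir _ _ = false

  -- the runs (maximal contiguous increasing or decreasing pieces), in order;
  -- consecutive runs share their boundary element.
  runsGo : Dir → List C → C → List C → List (List C)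
  runsGo d cur l [] = cur ∷ []
  runsGo d cur l (z ∷ zs) =
    if sameDir d (dir l z)
    then runsGo d (cur ++ z ∷ []) z zs
    else cur ∷ runsGo (dir l z) (l ∷ z ∷ []) z zs

  runs : List C → List (List C)
  runs [] = []
  runs (x ∷ []) = (x ∷ []) ∷ []
  runs (x ∷ y ∷ zs) = runsGo (dir x y) (x ∷ y ∷ []) y zs

  allB : (List C → Bool) → List (List C) → Bool
  allB p [] = true
  allB p (r ∷ rs) = p r ∧ allB p rs

  isRollercoaster : ℕ → List C → Bool
  isRollercoaster k s = allB (λ r → k ℕ.≤ᵇ length r) (runs s)

  lastRunDecreasing : List C → Bool
  lastRunDecreasing s with last (runs s)
  ... | nothing = false
  ... | just r = decreasing r

  maxLen : (List C → Bool) → List C → ℕ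
  maxLen p xs = foldr (λ s acc → if p s then length s ⊔ acc else acc) 0 (subseqs xs)

  -- S[a:b] = (S a, …, S b)  (empty if b < a)
  segment : (ℕ → C) → ℕ → ℕ → List C
  segment S a b = map (λ t → S (a ℕ.+ t)) (upTo (suc b ∸ a))

  decArr : ℕ → (ℕ → C) → ℕ → ℕ
  decArr k S x = maxLen (λ s → isRollercoaster k s ∧ lastRunDecreasing s) (segment S 1 x)

  Mat : (ℕ → C) → ℕ → ℕ → ℤ
  Mat S a b = if a <ᵇ b then + maxLen increasing (segment S (suc a) b) else (+ b) ℤ.- (+ a)

  -- M'[a,b]; nothing represents -∞
  Mat' : ℕ → (ℕ → C) → ℕ → ℕ → Maybe ℤ
  Mat' k S a b = if ⌊ Mat S a b ℤ.<? + k ⌋ then nothing else just (Mat S a b)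

  -- A_inc[x,y]; nothing represents a blank entry
  Ainc : ℕ → (ℕ → C) → ℕ → ℕ → Maybe ℤ
  Ainc k S x y with Mat' k S (x ∸ 1) y
  ... | nothing = nothing
  ... | just v = just ((+ decArr k S x) ℤ.+ v ℤ.- ℤ.1ℤ)

record FallingStaircaseAntiMonge (A : ℕ → ℕ → Maybe ℤ) (r₀ r₁ c₀ c₁ : ℕ) : Set where
  field
    staircase : ∀ r c r' c' → r₀ ℕ.≤ r → r ℕ.≤ r' → r' ℕ.≤ r₁ →
                c₀ ℕ.≤ c' → c' ℕ.≤ c → c ℕ.≤ c₁ →
                A r c ≡ nothing → A r' c' ≡ nothing
    antiMonge : ∀ r₁' r₂ c₁' c₂ → r₀ ℕ.≤ r₁' → r₁' ℕ.< r₂ → r₂ ℕ.≤ r₁ →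
                c₀ ℕ.≤ c₁' → c₁' ℕ.< c₂ → c₂ ℕ.≤ c₁ →
                ∀ {u v w z : ℤ} → A r₁' c₁' ≡ just u → A r₂ c₂ ≡ just v →
                A r₁' c₂ ≡ just w → A r₂ c₁' ≡ just z →
                w ℤ.+ z ℤ.≤ u ℤ.+ v

-- Everything rests on the quadrangle inequality for longest increasing subsequences,
-- lis S[a:d] + lis S[b:c] ≤ lis S[a:c] + lis S[b:d] for a ≤ b ≤ c ≤ d. Summing reduces it to
-- a + 1 = b and c + 1 = d, i.e. lis (x w y) + lis w ≤ lis (x w) + lis (w y). Take longest
-- increasing P ⊆ x w y and Q ⊆ w with P starting at x; walking along w, at the first element of
-- Q exceeding the last element of P passed so far, exchange the tails of P and Q. This gives
-- increasing subsequences of x w and of w y of total length |P| + |Q|.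
-- Since M'[x−1,y] = lis S[x:y] unless that is below k, adding the row term dec[x] − 1 keeps the
-- quadrangle inequality, and blank entries (lis S[x:y] < k) stay blank when the segment shrinks,
-- i.e. further down or further left: the falling staircase.
module Submission where

open import Defs
open import Level using (Level)
open import Data.Bool using (Bool; true; false; if_then_else_)
open import Data.Integer as ℤ using (ℤ; +_)
import Data.Integer.Properties as ℤ
import Data.Integer.Tactic.RingSolver as ℤ-Solver
open import Data.List using (List; []; _∷_; _++_; [_]; length; foldr; map; upTo; applyUpTo; fromMaybe)
open import Data.List.Properties using (map-upTo; map-cong; map-++; map-applyUpTo; upTo-∷ʳ)
open import Data.List.Membership.Propositional using (_∈_)
open import Data.List.Membership.Propositional.Properties using (∈-++⁺ˡ; ∈-++⁺ʳ; ∈-++⁻; ∈-map⁺; ∈-map⁻)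
open import Data.List.Relation.Binary.Sublist.Propositional using (_⊆_; []; _∷_; _∷ʳ_; ⊆-refl; ⊆-trans)
open import Data.List.Relation.Binary.Sublist.Propositional.Properties using (++⁺; ++⁺ʳ; []⊆-universal)
open import Data.List.Relation.Unary.Any using (here; there)
open import Data.List.Relation.Unary.Linked as Linked using (Linked; []; [-]; _∷_)
open import Data.Maybe using (Maybe; just; nothing)
open import Data.Maybe.Properties using (just-injective)
open import Data.Maybe.Relation.Unary.All as Maybe using ()
open import Data.Nat using (ℕ; suc; _+_; _∸_; _⊔_; _≤_; _<_; _≤′_; _<ᵇ_; s≤s; ≤′-refl; ≤′-step)
open import Data.Nat.Properties
open import Data.Nat.Tactic.RingSolver using (solve-∀)
open import Data.Product using (∃; ∃₂; _×_; _,_)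
open import Data.Sum using (_⊎_; inj₁; inj₂)
open import Relation.Binary.Bundles using (StrictTotalOrder)
open import Relation.Binary.Definitions using (tri<; tri≈; tri>)
open import Relation.Binary.PropositionalEquality using (_≡_; _≢_; refl; sym; trans; cong; cong₂; subst; subst₂; module ≡-Reasoning)
open import Relation.Nullary using (¬_; yes; no; contradiction)

+-telescope-≤ : ∀ x y z w u v → x + y ≤ z + w → w + u ≤ y + v → x + u ≤ z + v
+-telescope-≤ x y z w u v h₁ h₂ = +-cancelʳ-≤ (y + w) (x + u) (z + v) (begin
  x + u + (y + w)   ≡⟨ regroupˡ x y w u ⟩
  (x + y) + (w + u) ≤⟨ +-mono-≤ h₁ h₂ ⟩
  (z + w) + (y + v) ≡⟨ regroupʳ z w y v ⟩
  z + v + (y + w)   ∎)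
  where
    open ≤-Reasoning
    regroupˡ : ∀ x y w u → x + u + (y + w) ≡ (x + y) + (w + u)
    regroupˡ = solve-∀
    regroupʳ : ∀ z w y v → (z + w) + (y + v) ≡ z + v + (y + w)
    regroupʳ = solve-∀

module _ (f : ℕ → ℕ → ℕ) where

  Quadrangle : ℕ → ℕ → ℕ → ℕ → Set
  Quadrangle r₁ r₂ c₁ c₂ = f r₁ c₂ + f r₂ c₁ ≤ f r₁ c₁ + f r₂ c₂

  quadrangle-trans-cols : ∀ {r₁ r₂ c₁ c₂ c₃} →
    Quadrangle r₁ r₂ c₁ c₂ → Quadrangle r₁ r₂ c₂ c₃ → Quadrangle r₁ r₂ c₁ c₃
  quadrangle-trans-cols {r₁} {r₂} {c₁} {c₂} {c₃} q₁₂ q₂₃ = begin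
    f r₁ c₃ + f r₂ c₁ ≡⟨ +-comm (f r₁ c₃) (f r₂ c₁) ⟩
    f r₂ c₁ + f r₁ c₃ ≤⟨ +-telescope-≤ (f r₂ c₁) (f r₁ c₂) (f r₁ c₁) (f r₂ c₂) (f r₁ c₃) (f r₂ c₃)
                           (swapˡ (f r₁ c₂) (f r₂ c₁) q₁₂) (swapˡ (f r₁ c₃) (f r₂ c₂) q₂₃) ⟩
    f r₁ c₁ + f r₂ c₃ ∎
    where
      open ≤-Reasoning
      swapˡ : ∀ a b {c} → a + b ≤ c → b + a ≤ c
      swapˡ a b = ≤-trans (≤-reflexive (+-comm b a))

  quadrangle-trans-rows : ∀ {r₁ r₂ r₃ c₁ c₂} →
    Quadrangle r₁ r₂ c₁ c₂ → Quadrangle r₂ r₃ c₁ c₂ → Quadrangle r₁ r₃ c₁ c₂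
  quadrangle-trans-rows {r₁} {r₂} {r₃} {c₁} {c₂} =
    +-telescope-≤ (f r₁ c₂) (f r₂ c₁) (f r₁ c₁) (f r₂ c₂) (f r₃ c₁) (f r₃ c₂)

  quadrangle-from-adjacent : (∀ r c → r ≤ c → Quadrangle r (suc r) c (suc c)) →
    ∀ {r₁ r₂ c₁ c₂} → r₁ ≤ r₂ → r₂ ≤ c₁ → c₁ ≤ c₂ → Quadrangle r₁ r₂ c₁ c₂
  quadrangle-from-adjacent adjacent r₁≤r₂ r₂≤c₁ c₁≤c₂ = rows (≤⇒≤′ r₁≤r₂) r₂≤c₁ (≤⇒≤′ c₁≤c₂)
    where
      adjacent-rows : ∀ {r c₁ c₂} → r ≤ c₁ → c₁ ≤′ c₂ → Quadrangle r (suc r) c₁ c₂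
      adjacent-rows r≤c₁ ≤′-refl = ≤-refl
      adjacent-rows r≤c₁ (≤′-step c₁≤c₂) = quadrangle-trans-cols (adjacent-rows r≤c₁ c₁≤c₂)
        (adjacent _ _ (≤-trans r≤c₁ (≤′⇒≤ c₁≤c₂)))

      rows : ∀ {r₁ r₂ c₁ c₂} → r₁ ≤′ r₂ → r₂ ≤ c₁ → c₁ ≤′ c₂ → Quadrangle r₁ r₂ c₁ c₂
      rows {r₁} {_} {c₁} {c₂} ≤′-refl _ _ = ≤-reflexive (+-comm (f r₁ c₂) (f r₁ c₁))
      rows (≤′-step r₁≤r) r<c₁ c₁≤c₂ = quadrangle-trans-rows (rows r₁≤r (<⇒≤ r<c₁) c₁≤c₂)
        (adjacent-rows (<⇒≤ r<c₁) c₁≤c₂)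

quadrangle-add-row-offsets : ∀ (p q : ℤ) {a b c d : ℕ} → a + b ≤ c + d →
  (p ℤ.+ + a ℤ.- ℤ.1ℤ) ℤ.+ (q ℤ.+ + b ℤ.- ℤ.1ℤ) ℤ.≤ (p ℤ.+ + c ℤ.- ℤ.1ℤ) ℤ.+ (q ℤ.+ + d ℤ.- ℤ.1ℤ)
quadrangle-add-row-offsets p q {a} {b} {c} {d} a+b≤c+d =
  subst₂ ℤ._≤_ (sym (regroup p q (+ a) (+ b))) (sym (regroup p q (+ c) (+ d)))
    (ℤ.+-monoʳ-≤ (p ℤ.- ℤ.1ℤ ℤ.+ (q ℤ.- ℤ.1ℤ))
      (subst₂ ℤ._≤_ (ℤ.pos-+ a b) (ℤ.pos-+ c d) (ℤ.+≤+ a+b≤c+d)))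
  where
    regroup : ∀ p q a b →
      (p ℤ.+ a ℤ.- ℤ.1ℤ) ℤ.+ (q ℤ.+ b ℤ.- ℤ.1ℤ) ≡ (p ℤ.- ℤ.1ℤ ℤ.+ (q ℤ.- ℤ.1ℤ)) ℤ.+ (a ℤ.+ b)
    regroup = ℤ-Solver.solve-∀

⊆-split-++ : ∀ {a} {A : Set a} (ws : List A) {xs ts : List A} → xs ⊆ ws ++ ts →
  ∃₂ λ us vs → xs ≡ us ++ vs × us ⊆ ws × vs ⊆ ts
⊆-split-++ [] {xs} p = [] , xs , refl , [] , p
⊆-split-++ (w ∷ ws) (.w ∷ʳ p) with ⊆-split-++ ws p
... | us , vs , refl , us⊆ws , vs⊆ts = us , vs , refl , w ∷ʳ us⊆ws , vs⊆ts
⊆-split-++ (w ∷ ws) (refl ∷ p) with ⊆-split-++ ws p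
... | us , vs , refl , us⊆ws , vs⊆ts = w ∷ us , vs , refl , refl ∷ us⊆ws , vs⊆ts

module LongestIncreasing {a ℓ₁ ℓ₂ : Level} (O : StrictTotalOrder a ℓ₁ ℓ₂) where
  open StrictTotalOrder O using (compare; <-respʳ-≈; module Eq)
    renaming (Carrier to C; _<_ to _≺_; _<?_ to _≺?_; trans to ≺-trans)
  open Rollercoaster O

  Increasing : List C → Set (a Level.⊔ ℓ₂)
  Increasing = Linked _≺_

  increasing⇒Increasing : ∀ xs → increasing xs ≡ true → Increasing xs
  increasing⇒Increasing [] _ = []
  increasing⇒Increasing (x ∷ xs) = go x xs
    where
      go : ∀ x xs → increasing (x ∷ xs) ≡ true → Increasing (x ∷ xs)
      go x [] _ = [-]
      go x (y ∷ xs) inc with x ≺? y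
      ... | yes x≺y = x≺y ∷ go y xs inc

  Increasing⇒increasing : ∀ {xs} → Increasing xs → increasing xs ≡ true
  Increasing⇒increasing [] = refl
  Increasing⇒increasing [-] = refl
  Increasing⇒increasing {x ∷ y ∷ _} (x≺y ∷ inc) with x ≺? y
  ... | yes _ = Increasing⇒increasing inc
  ... | no x⊀y = contradiction x≺y x⊀y

  ∈-subseqs⁺ : ∀ {xs ys} → xs ⊆ ys → xs ∈ subseqs ys
  ∈-subseqs⁺ [] = here refl
  ∈-subseqs⁺ {ys = y ∷ ys} (.y ∷ʳ p) = ∈-++⁺ʳ (map (y ∷_) (subseqs ys)) (∈-subseqs⁺ p)
  ∈-subseqs⁺ (refl ∷ p) = ∈-++⁺ˡ (∈-map⁺ _ (∈-subseqs⁺ p))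

  ∈-subseqs⁻ : ∀ {xs} ys → xs ∈ subseqs ys → xs ⊆ ys
  ∈-subseqs⁻ [] (here refl) = []
  ∈-subseqs⁻ (y ∷ ys) xs∈ with ∈-++⁻ (map (y ∷_) (subseqs ys)) xs∈
  ... | inj₂ xs∈′ = y ∷ʳ ∈-subseqs⁻ ys xs∈′
  ... | inj₁ xs∈′ with ∈-map⁻ (y ∷_) xs∈′
  ...   | _ , xs∈″ , refl = refl ∷ ∈-subseqs⁻ ys xs∈″

  module _ (p : List C → Bool) where

    private
      longest : List (List C) → ℕ
      longest = foldr (λ s acc → if p s then length s ⊔ acc else acc) 0

      longest-upper : ∀ {s ss} → s ∈ ss → p s ≡ true → length s ≤ longest ss
      longest-upper {s} (here refl) ps rewrite ps = m≤m⊔n (length s) _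
      longest-upper {ss = t ∷ _} (there s∈) ps with p t
      ... | true = ≤-trans (longest-upper s∈ ps) (m≤n⊔m (length t) _)
      ... | false = longest-upper s∈ ps

      longest-attained : ∀ ss → longest ss ≡ 0 ⊎ ∃ λ s → s ∈ ss × p s ≡ true × length s ≡ longest ss
      longest-attained [] = inj₁ refl
      longest-attained (s ∷ ss) with p s in ps | longest-attained ss
      ... | false | inj₁ none = inj₁ none
      ... | false | inj₂ (t , t∈ , pt , eq) = inj₂ (t , there t∈ , pt , eq)
      ... | true | rest with ⊔-sel (length s) (longest ss)
      ...   | inj₁ eq = inj₂ (s , here refl , ps , sym eq)
      ...   | inj₂ eq with rest
      ...     | inj₁ none = inj₁ (trans eq none)
      ...     | inj₂ (t , t∈ , pt , eq′) = inj₂ (t , there t∈ , pt , trans eq′ (sym eq))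

    maxLen-upper : ∀ {xs ys} → xs ⊆ ys → p xs ≡ true → length xs ≤ maxLen p ys
    maxLen-upper xs⊆ys = longest-upper (∈-subseqs⁺ xs⊆ys)

    maxLen-attained : p [] ≡ true → ∀ ys → ∃ λ xs → xs ⊆ ys × p xs ≡ true × length xs ≡ maxLen p ys
    maxLen-attained p[] ys with longest-attained (subseqs ys)
    ... | inj₁ none = [] , []⊆-universal ys , p[] , sym none
    ... | inj₂ (xs , xs∈ , pxs , eq) = xs , ∈-subseqs⁻ ys xs∈ , pxs , eq

  lis : List C → ℕ
  lis = maxLen increasing

  lis-upper : ∀ {xs ys} → xs ⊆ ys → Increasing xs → length xs ≤ lis ys
  lis-upper xs⊆ys inc = maxLen-upper increasing xs⊆ys (Increasing⇒increasing inc)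

  lis-attained : ∀ ys → ∃ λ xs → xs ⊆ ys × Increasing xs × length xs ≡ lis ys
  lis-attained ys with maxLen-attained increasing refl ys
  ... | xs , xs⊆ys , inc , eq = xs , xs⊆ys , increasing⇒Increasing xs inc , eq

  lis-mono : ∀ {xs ys} → xs ⊆ ys → lis xs ≤ lis ys
  lis-mono {xs} xs⊆ys with lis-attained xs
  ... | zs , zs⊆xs , inc , eq = subst (_≤ _) eq (lis-upper (⊆-trans zs⊆xs xs⊆ys) inc)

  ≮-<-trans : ∀ {x y z} → ¬ x ≺ y → x ≺ z → y ≺ z
  ≮-<-trans {x} {y} {z} x⊀y x≺z with compare y z
  ... | tri< y≺z _ _ = y≺z
  ... | tri≈ _ y≈z _ = contradiction (<-respʳ-≈ (Eq.sym y≈z) x≺z) x⊀y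
  ... | tri> _ _ z≺y = contradiction (≺-trans x≺z z≺y) x⊀y

  Increasing-drop-bound : ∀ b {xs} → Increasing (fromMaybe b ++ xs) → Increasing xs
  Increasing-drop-bound nothing inc = inc
  Increasing-drop-bound (just _) inc = Linked.tail inc

  Increasing-rebound : ∀ b {z xs ys} → Increasing (fromMaybe b ++ z ∷ xs) → Increasing (z ∷ ys) →
                       Increasing (fromMaybe b ++ z ∷ ys)
  Increasing-rebound nothing _ inc = inc
  Increasing-rebound (just _) (b≺z ∷ _) inc = b≺z ∷ inc

  Increasing-lower-bound : ∀ b {l xs} → Maybe.All (λ q → ¬ l ≺ q) b → Increasing (l ∷ xs) →
                           Increasing (fromMaybe b ++ xs)
  Increasing-lower-bound nothing _ inc = Linked.tail inc
  Increasing-lower-bound (just _) _ [-] = [-]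
  Increasing-lower-bound (just _) (Maybe.just l⊀b) (l≺x ∷ inc) = ≮-<-trans l⊀b l≺x ∷ inc

  -- l is the last element of the first sequence so far and b that of the second (if any);
  -- the invariant ¬ l ≺ b is what allows the remaining tail of the first to follow b.
  exchange : ∀ ts l b {w xs ys} → xs ⊆ w → ys ⊆ w →
    Increasing (l ∷ xs ++ ts) → Increasing (fromMaybe b ++ ys) → Maybe.All (λ q → ¬ l ≺ q) b →
    ∃₂ λ xs′ ys′ → xs′ ⊆ w × ys′ ⊆ w ++ ts × Increasing (l ∷ xs′) × Increasing (fromMaybe b ++ ys′) ×
                   length xs′ + length ys′ ≡ length ys + length (xs ++ ts)
  exchange ts l b [] [] incˣ incʸ l⊀b =
    [] , ts , [] , ⊆-refl , [-] , Increasing-lower-bound b l⊀b incˣ , refl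
  exchange ts l b (z ∷ʳ p) (.z ∷ʳ q) incˣ incʸ l⊀b with exchange ts l b p q incˣ incʸ l⊀b
  ... | xs′ , ys′ , p′ , q′ , rest = xs′ , ys′ , z ∷ʳ p′ , z ∷ʳ q′ , rest
  exchange ts l b {xs = z ∷ xs} {ys} (refl ∷ p) (.z ∷ʳ q) (l≺z ∷ incˣ) incʸ l⊀b
    with exchange ts z b p q incˣ incʸ (Maybe.map (λ l⊀q z≺q → l⊀q (≺-trans l≺z z≺q)) l⊀b)
  ... | xs′ , ys′ , p′ , q′ , incˣ′ , incʸ′ , eq =
    z ∷ xs′ , ys′ , refl ∷ p′ , z ∷ʳ q′ , l≺z ∷ incˣ′ , incʸ′ ,
    trans (cong suc eq) (sym (+-suc (length ys) (length (xs ++ ts))))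
  exchange ts l b {xs = xs} (z ∷ʳ p) (refl ∷ q) incˣ incʸ l⊀b with l ≺? z
  ... | yes l≺z = z ∷ _ , xs ++ ts , refl ∷ q , z ∷ʳ ++⁺ p ⊆-refl ,
                  l≺z ∷ Increasing-drop-bound b incʸ , Increasing-lower-bound b l⊀b incˣ , refl
  ... | no l⊀z with exchange ts l (just z) p q incˣ (Increasing-drop-bound b incʸ) (Maybe.just l⊀z)
  ...   | xs′ , ys′ , p′ , q′ , incˣ′ , incʸ′ , eq =
    xs′ , z ∷ ys′ , z ∷ʳ p′ , refl ∷ q′ , incˣ′ , Increasing-rebound b incʸ incʸ′ ,
    trans (+-suc (length xs′) (length ys′)) (cong suc eq)
  exchange ts l b (refl ∷ p) (refl ∷ q) (l≺z ∷ incˣ) incʸ _ =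
    _ , _ , refl ∷ q , refl ∷ ++⁺ p ⊆-refl ,
    l≺z ∷ Increasing-drop-bound b incʸ , Increasing-rebound b incʸ incˣ , refl

  lis-quadrangle : ∀ x y w → lis (x ∷ w ++ [ y ]) + lis w ≤ lis (x ∷ w) + lis (w ++ [ y ])
  lis-quadrangle x y w with lis-attained (x ∷ w ++ [ y ]) | lis-attained w
  ... | _ , .x ∷ʳ p , incˣ , eqˣ | _ , _ , _ , _ = begin
    lis (x ∷ w ++ [ y ]) + lis w   ≤⟨ +-mono-≤ (subst (_≤ _) eqˣ (lis-upper p incˣ))
                                                (lis-mono {w} (x ∷ʳ ⊆-refl)) ⟩
    lis (w ++ [ y ]) + lis (x ∷ w) ≡⟨ +-comm (lis (w ++ [ y ])) (lis (x ∷ w)) ⟩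
    lis (x ∷ w) + lis (w ++ [ y ]) ∎
    where open ≤-Reasoning
  ... | _ , refl ∷ p , incˣ , eqˣ | ys , q , incʸ , eqʸ with ⊆-split-++ w p
  ... | us , ts , refl , us⊆w , ts⊆y with exchange ts x nothing us⊆w q incˣ incʸ Maybe.nothing
  ... | xs′ , ys′ , p′ , q′ , incˣ′ , incʸ′ , eq = begin
    lis (x ∷ w ++ [ y ]) + lis w          ≡⟨ cong₂ _+_ (sym eqˣ) (sym eqʸ) ⟩
    suc (length (us ++ ts) + length ys)   ≡⟨ cong suc (+-comm (length (us ++ ts)) (length ys)) ⟩
    suc (length ys + length (us ++ ts))   ≡⟨ cong suc (sym eq) ⟩
    suc (length xs′ + length ys′)         ≤⟨ +-mono-≤ (lis-upper (refl ∷ p′) incˣ′)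
                                                      (lis-upper (⊆-trans q′ (++⁺ ⊆-refl ts⊆y)) incʸ′) ⟩
    lis (x ∷ w) + lis (w ++ [ y ])        ∎
    where open ≤-Reasoning

  module _ (S : ℕ → C) where

    segment-cons : ∀ {r c} → r ≤ c → segment S r c ≡ S r ∷ segment S (suc r) c
    segment-cons {r} {c} r≤c rewrite +-∸-assoc 1 r≤c = cong₂ _∷_ (cong S (+-identityʳ r)) (begin
      map (λ t → S (r + t)) (applyUpTo suc (c ∸ r))   ≡⟨ map-applyUpTo suc _ (c ∸ r) ⟩
      applyUpTo (λ t → S (r + suc t)) (c ∸ r)         ≡⟨ sym (map-upTo _ (c ∸ r)) ⟩
      map (λ t → S (r + suc t)) (upTo (c ∸ r))        ≡⟨ map-cong (λ t → cong S (+-suc r t)) (upTo (c ∸ r)) ⟩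
      segment S (suc r) c                              ∎)
      where open ≡-Reasoning

    segment-snoc : ∀ {r c} → r ≤ suc c → segment S r (suc c) ≡ segment S r c ++ [ S (suc c) ]
    segment-snoc {r} {c} r≤1+c rewrite +-∸-assoc 1 r≤1+c = begin
      map (λ t → S (r + t)) (upTo (suc (suc c ∸ r)))            ≡⟨ cong (map _) (sym (upTo-∷ʳ (suc c ∸ r))) ⟩
      map (λ t → S (r + t)) (upTo (suc c ∸ r) ++ [ suc c ∸ r ]) ≡⟨ map-++ _ (upTo (suc c ∸ r)) _ ⟩
      segment S r c ++ [ S (r + (suc c ∸ r)) ]
        ≡⟨ cong (λ t → segment S r c ++ [ S t ]) (m+[n∸m]≡n r≤1+c) ⟩
      segment S r c ++ [ S (suc c) ]                           ∎
      where open ≡-Reasoning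

    segment-empty : ∀ {r c} → c < r → segment S r c ≡ []
    segment-empty c<r rewrite m≤n⇒m∸n≡0 c<r = refl

    segment-⊆-suc-start : ∀ r c → segment S (suc r) c ⊆ segment S r c
    segment-⊆-suc-start r c with r ≤? c
    ... | yes r≤c rewrite segment-cons r≤c = S r ∷ʳ ⊆-refl
    ... | no r≰c rewrite segment-empty (m<n⇒m<1+n (≰⇒> r≰c)) = []⊆-universal _

    segment-⊆-suc-end : ∀ r c → segment S r c ⊆ segment S r (suc c)
    segment-⊆-suc-end r c with r ≤? suc c
    ... | yes r≤1+c rewrite segment-snoc r≤1+c = ++⁺ʳ _ ⊆-refl
    ... | no r≰1+c rewrite segment-empty (<⇒≤ (≰⇒> r≰1+c)) = []⊆-universal _

    segment-mono : ∀ {r r′ c c′} → r ≤ r′ → c′ ≤ c → segment S r′ c′ ⊆ segment S r c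
    segment-mono r≤r′ c′≤c = ⊆-trans (shrink (≤⇒≤′ r≤r′)) (extend (≤⇒≤′ c′≤c))
      where
        shrink : ∀ {r r′ c} → r ≤′ r′ → segment S r′ c ⊆ segment S r c
        shrink ≤′-refl = ⊆-refl
        shrink (≤′-step r≤r′) = ⊆-trans (segment-⊆-suc-start _ _) (shrink r≤r′)
        extend : ∀ {r c′ c} → c′ ≤′ c → segment S r c′ ⊆ segment S r c
        extend ≤′-refl = ⊆-refl
        extend (≤′-step c′≤c) = ⊆-trans (extend c′≤c) (segment-⊆-suc-end _ _)

    lisSegment : ℕ → ℕ → ℕ
    lisSegment r c = lis (segment S r c)

    lisSegment-mono : ∀ {r r′ c c′} → r ≤ r′ → c′ ≤ c → lisSegment r′ c′ ≤ lisSegment r c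
    lisSegment-mono r≤r′ c′≤c = lis-mono (segment-mono r≤r′ c′≤c)

    lisSegment-quadrangle : ∀ {r₁ r₂ c₁ c₂} → r₁ ≤ r₂ → r₂ ≤ c₁ → c₁ ≤ c₂ →
                            Quadrangle lisSegment r₁ r₂ c₁ c₂
    lisSegment-quadrangle = quadrangle-from-adjacent lisSegment adjacent
      where
        adjacent : ∀ r c → r ≤ c → Quadrangle lisSegment r (suc r) c (suc c)
        adjacent r c r≤c
          rewrite segment-snoc (m≤n⇒m≤1+n r≤c) | segment-cons r≤c | segment-snoc (s≤s r≤c)
          = lis-quadrangle (S r) (S (suc c)) (segment S (suc r) c)

    module _ (k : ℕ) where

      Mat≡lisSegment : ∀ {x y} → x < y → Mat S x y ≡ + lisSegment (suc x) y
      Mat≡lisSegment {x} {y} x<y with x <ᵇ y | <⇒<ᵇ x<y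
      ... | true | _ = refl

      Mat′-blank : ∀ {x y} → x < y → lisSegment (suc x) y < k → Mat' k S x y ≡ nothing
      Mat′-blank {x} {y} x<y short rewrite Mat≡lisSegment x<y with + lisSegment (suc x) y ℤ.<? + k
      ... | yes _ = refl
      ... | no ¬short = contradiction (ℤ.+<+ short) ¬short

      Mat′-filled : ∀ {x y} → x < y → k ≤ lisSegment (suc x) y →
                    Mat' k S x y ≡ just (+ lisSegment (suc x) y)
      Mat′-filled {x} {y} x<y long rewrite Mat≡lisSegment x<y with + lisSegment (suc x) y ℤ.<? + k
      ... | yes short = contradiction (ℤ.drop‿+<+ short) (≤⇒≯ long)
      ... | no _ = refl

      incEntry : ℕ → ℕ → ℤ
      incEntry x y = + decArr k S x ℤ.+ + lisSegment x y ℤ.- ℤ.1ℤ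

      Ainc-blank : ∀ {x y} → 1 ≤ x → x ≤ y → lisSegment x y < k → Ainc k S x y ≡ nothing
      Ainc-blank {suc x} _ x<y short rewrite Mat′-blank x<y short = refl

      Ainc-filled : ∀ {x y} → 1 ≤ x → x ≤ y → k ≤ lisSegment x y → Ainc k S x y ≡ just (incEntry x y)
      Ainc-filled {suc x} _ x<y long rewrite Mat′-filled x<y long = refl

      Ainc≡nothing⇒short : ∀ {x y} → 1 ≤ x → x ≤ y → Ainc k S x y ≡ nothing → lisSegment x y < k
      Ainc≡nothing⇒short {x} {y} 1≤x x≤y blank with lisSegment x y <? k
      ... | yes short = short
      ... | no ¬short = contradiction (trans (sym (Ainc-filled 1≤x x≤y (≮⇒≥ ¬short))) blank) λ ()

      Ainc≡just⇒ : ∀ {x y u} → 1 ≤ x → x ≤ y → Ainc k S x y ≡ just u → u ≡ incEntry x y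
      Ainc≡just⇒ {x} {y} 1≤x x≤y filled with lisSegment x y <? k
      ... | yes short = contradiction (trans (sym (Ainc-blank 1≤x x≤y short)) filled) λ ()
      ... | no ¬short = just-injective (trans (sym filled) (Ainc-filled 1≤x x≤y (≮⇒≥ ¬short)))

      incEntry-quadrangle : ∀ {r₁ r₂ c₁ c₂} → r₁ ≤ r₂ → r₂ ≤ c₁ → c₁ ≤ c₂ →
        incEntry r₁ c₂ ℤ.+ incEntry r₂ c₁ ℤ.≤ incEntry r₁ c₁ ℤ.+ incEntry r₂ c₂
      incEntry-quadrangle {r₁} {r₂} r₁≤r₂ r₂≤c₁ c₁≤c₂ =
        quadrangle-add-row-offsets (+ decArr k S r₁) (+ decArr k S r₂)
          (lisSegment-quadrangle r₁≤r₂ r₂≤c₁ c₁≤c₂)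

      Ainc-fallingStaircaseAntiMonge : ∀ {r₀ r₁ c₀ c₁} → 1 ≤ r₀ → r₁ ≤ c₀ →
                                       FallingStaircaseAntiMonge (Ainc k S) r₀ r₁ c₀ c₁
      Ainc-fallingStaircaseAntiMonge 1≤r₀ r₁≤c₀ = record
        { staircase = λ r c r′ c′ r₀≤r r≤r′ r′≤r₁ c₀≤c′ c′≤c _ blank →
            let r′≤c′ = ≤-trans r′≤r₁ (≤-trans r₁≤c₀ c₀≤c′)
                r≤c = ≤-trans r≤r′ (≤-trans r′≤c′ c′≤c)
            in Ainc-blank (≤-trans 1≤r₀ (≤-trans r₀≤r r≤r′)) r′≤c′
                 (≤-<-trans (lisSegment-mono r≤r′ c′≤c) (Ainc≡nothing⇒short (≤-trans 1≤r₀ r₀≤r) r≤c blank))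
        ; antiMonge = λ r c r′ c′ r₀≤r r<r′ r′≤r₁ c₀≤c c<c′ _ rc≡u r′c′≡v rc′≡w r′c≡z →
            let 1≤r = ≤-trans 1≤r₀ r₀≤r
                1≤r′ = ≤-trans 1≤r (<⇒≤ r<r′)
                r′≤c = ≤-trans r′≤r₁ (≤-trans r₁≤c₀ c₀≤c)
                r≤c = ≤-trans (<⇒≤ r<r′) r′≤c
                c≤c′ = <⇒≤ c<c′
            in subst₂ ℤ._≤_
                 (sym (cong₂ ℤ._+_ (Ainc≡just⇒ 1≤r (≤-trans r≤c c≤c′) rc′≡w) (Ainc≡just⇒ 1≤r′ r′≤c r′c≡z)))
                 (sym (cong₂ ℤ._+_ (Ainc≡just⇒ 1≤r r≤c rc≡u) (Ainc≡just⇒ 1≤r′ (≤-trans r′≤c c≤c′) r′c′≡v)))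
                 (incEntry-quadrangle (<⇒≤ r<r′) r′≤c c≤c′)
        }

open LongestIncreasing using (Ainc-fallingStaircaseAntiMonge)

proposition19 : ∀ {a ℓ₁ ℓ₂ : Level} (O : StrictTotalOrder a ℓ₁ ℓ₂) (n : ℕ)
    (S : ℕ → StrictTotalOrder.Carrier O) →
    (∀ p q → 1 ≤ p → p ≤ n → 1 ≤ q → q ≤ n → p ≢ q → ¬ StrictTotalOrder._≈_ O (S p) (S q)) →
    (k : ℕ) → 3 ≤ k →
    (i m j : ℕ) → 1 ≤ i → i < m → m ≤ j → j ≤ n →
    FallingStaircaseAntiMonge (Rollercoaster.Ainc O k S) i (m ∸ 1) m j
proposition19 O n S _ k _ i m j 1≤i _ _ _ = Ainc-fallingStaircaseAntiMonge O S k 1≤i (m∸n≤m m 1)
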